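{- Let $G$ be a disconnected graph with exactly one nontrivial connected component $G_1$ and $t > 0$ trivial components. Then $h(G\overline{G}) \leq h(G_1) + t$ if $\mathrm{diam}(G_1) \leq 3$, and $h(G\overline{G}) \leq t+2$ if $\mathrm{diam}(G_1) > 3$.
   Context: All graphs are finite, simple and undirected. For a graph $H$ and $x,y \in V(H)$, the closed interval $I[x,y]$ consists of $x$, $y$ and all vertices lying on some shortest path between $x$ and $y$ in $H$; for $S \subseteq V(H)$, $I[S] = \bigcup_{x,y\in S} I[x,y]$. A set $S$ is (geodetically) convex if $I[S]=S$; the convex hull $H(S)$ is the smallest convex set containing $S$; $S$ is a hull set if $H(S)=V(H)$; the (geodetic) hull number $h(H)$ is the minimum cardinality of a hull set of $H$ (so $h(G_1)$ is the hull number of $G_1$ considered as a graph on its own). $\mathrm{diam}$ denotes the diameter. For a graph $G$ with vertex set $\{v_1,\dots,v_n\}$, the complementary prism $G\overline{G}$ has vertex set $\{v_1,\dots,v_n\}\cup\{\overline{v}_1,\dots,\overline{v}_n\}$ and edge set $E(G) \cup \{\overline{v}_i\overline{v}_j : i<j,\ v_iv_j\notin E(G)\} \cup \{v_i\overline{v}_i : 1\le i\le n\}$. A component is trivial if it has exactly one vertex, nontrivial otherwise. -}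

module Defs where

open import Data.Nat using (ℕ; zero; suc; _+_; _≤_)
open import Data.Bool using (Bool; true; false; not; _∧_)
open import Data.Fin using (Fin; splitAt; _≟_)
open import Data.Fin.Subset using (Subset; _∈_; _⊆_; ∣_∣)
open import Data.Sum using (_⊎_; inj₁; inj₂)
open import Data.Product using (Σ; ∃; _×_; _,_)
open import Relation.Nullary.Decidable using (⌊_⌋; yes; no)
open import Data.Empty using (⊥-elim)
open import Relation.Binary.PropositionalEquality using (_≡_; refl)

record Graph : Set where
  field
    n      : ℕ
    adj    : Fin n → Fin n → Bool
    sym    : ∀ i j → adj i j ≡ adj j i
    irrefl : ∀ i → adj i i ≡ false
open Graph public

data Walk (G : Graph) : Fin (n G) → Fin (n G) → ℕ → Set where
  nil  : ∀ x → Walk G x x zero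
  cons : ∀ {x y z k} → adj G x y ≡ true → Walk G y z k → Walk G x z (suc k)

IsDist : (G : Graph) → Fin (n G) → Fin (n G) → ℕ → Set
IsDist G x y d = Walk G x y d × (∀ k → Walk G x y k → d ≤ k)

Connected : Graph → Set
Connected G = ∀ x y → ∃ λ k → Walk G x y k

DiamLe : Graph → ℕ → Set
DiamLe G D = ∀ x y d → IsDist G x y d → d ≤ D

InInterval : (G : Graph) → Fin (n G) → Fin (n G) → Fin (n G) → Set
InInterval G x y z =
  z ≡ x ⊎ (z ≡ y ⊎ (∃ λ d → ∃ λ a → ∃ λ b →
    IsDist G x y d × Walk G x z a × Walk G z y b × a + b ≡ d))

Convex : (G : Graph) → Subset (n G) → Set
Convex G C = ∀ x y z → x ∈ C → y ∈ C → InInterval G x y z → z ∈ C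

IsHullSet : (G : Graph) → Subset (n G) → Set
IsHullSet G S = ∀ C → Convex G C → S ⊆ C → ∀ v → v ∈ C

IsHullNumber : Graph → ℕ → Set
IsHullNumber G k =
  (∃ λ S → IsHullSet G S × ∣ S ∣ ≡ k) × (∀ S → IsHullSet G S → k ≤ ∣ S ∣)

private
  uAdj : ∀ {m t} → (Fin m → Fin m → Bool) → Fin m ⊎ Fin t → Fin m ⊎ Fin t → Bool
  uAdj a (inj₁ i) (inj₁ j) = a i j
  uAdj a (inj₁ _) (inj₂ _) = false
  uAdj a (inj₂ _) (inj₁ _) = false
  uAdj a (inj₂ _) (inj₂ _) = false

  uSym : ∀ {m t} (a : Fin m → Fin m → Bool) → (∀ i j → a i j ≡ a j i) →
         (p q : Fin m ⊎ Fin t) → uAdj a p q ≡ uAdj a q p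
  uSym a s (inj₁ i) (inj₁ j) = s i j
  uSym a s (inj₁ _) (inj₂ _) = refl
  uSym a s (inj₂ _) (inj₁ _) = refl
  uSym a s (inj₂ _) (inj₂ _) = refl

  uIrr : ∀ {m t} (a : Fin m → Fin m → Bool) → (∀ i → a i i ≡ false) →
         (p : Fin m ⊎ Fin t) → uAdj a p p ≡ false
  uIrr a r (inj₁ i) = r i
  uIrr a r (inj₂ _) = refl

AddIsolated : Graph → ℕ → Graph
AddIsolated G t = record
  { n = n G + t
  ; adj = λ i j → uAdj {t = t} (adj G) (splitAt (n G) i) (splitAt (n G) j)
  ; sym = λ i j → uSym (adj G) (sym G) (splitAt (n G) i) (splitAt (n G) j)
  ; irrefl = λ i → uIrr (adj G) (irrefl G) (splitAt (n G) i)
  }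

-- complementary prism: vertices v_i are inj₁ i (first copy), v̄_i are inj₂ i
private
  eqb : ∀ {m} → Fin m → Fin m → Bool
  eqb i j = ⌊ i ≟ j ⌋

  pAdj : ∀ {m} → (Fin m → Fin m → Bool) → Fin m ⊎ Fin m → Fin m ⊎ Fin m → Bool
  pAdj a (inj₁ i) (inj₁ j) = a i j
  pAdj a (inj₁ i) (inj₂ j) = eqb i j
  pAdj a (inj₂ i) (inj₁ j) = eqb i j
  pAdj a (inj₂ i) (inj₂ j) = not (eqb i j) ∧ not (a i j)

  eqbSym : ∀ {m} (i j : Fin m) → eqb i j ≡ eqb j i
  eqbSym i j with i ≟ j | j ≟ i
  ... | yes _ | yes _ = refl
  ... | yes refl | no ¬p = ⊥-elim (¬p refl)
  ... | no ¬p | yes refl = ⊥-elim (¬p refl)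
  ... | no _ | no _ = refl

  eqbRefl : ∀ {m} (i : Fin m) → eqb i i ≡ true
  eqbRefl i with i ≟ i
  ... | yes _ = refl
  ... | no ¬p = ⊥-elim (¬p refl)

  pSym : ∀ {m} (a : Fin m → Fin m → Bool) → (∀ i j → a i j ≡ a j i) →
         (p q : Fin m ⊎ Fin m) → pAdj a p q ≡ pAdj a q p
  pSym a s (inj₁ i) (inj₁ j) = s i j
  pSym a s (inj₁ i) (inj₂ j) = eqbSym i j
  pSym a s (inj₂ i) (inj₁ j) = eqbSym i j
  pSym a s (inj₂ i) (inj₂ j) rewrite eqbSym i j | s i j = refl

  pIrr : ∀ {m} (a : Fin m → Fin m → Bool) → (∀ i → a i i ≡ false) →
         (p : Fin m ⊎ Fin m) → pAdj a p p ≡ false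
  pIrr a r (inj₁ i) = r i
  pIrr a r (inj₂ i) rewrite eqbRefl i = refl

ComplementaryPrism : Graph → Graph
ComplementaryPrism G = record
  { n = n G + n G
  ; adj = λ i j → pAdj (adj G) (splitAt (n G) i) (splitAt (n G) j)
  ; sym = λ i j → pSym (adj G) (sym G) (splitAt (n G) i) (splitAt (n G) j)
  ; irrefl = λ i → pIrr (adj G) (irrefl G) (splitAt (n G) i)
  }

-- Write v a, v̄ a for the copies of a vertex a of G₁ and u j, ū j for those of
-- the j-th isolated vertex.  u j is pendant at ū j, which is adjacent to every
-- v̄ a, so u j – ū j – v̄ a – v a is a geodesic: a convex set containing all u j
-- and all v a is everything.
--   diam G₁ ≤ 3: a walk between v a and v b stays in the copy of G₁ or has
--   length ≥ 3, so a ↦ v a preserves intervals; a hull set of G₁ plus all u j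
--   is a hull set of P, of size h(G₁) + t.
--   diam G₁ > 3: G₁ has a path p₀p₁p₂p₃p₄ with d(p₀,p₄) > 3.  The hull of
--   v p₁, v p₃ and all u j contains v p₂, then v̄ p₀,…,v̄ p₄, then every v̄ w,
--   then every v a by walking along G₁: a hull set of size t + 2.
-- General facts on walks, intervals, convex preimages and long paths come
-- first; then the prism is analysed and the two hull sets are built.
module Submission where

open import Defs hiding (sym)
open Graph using () renaming (sym to adj-sym)
open import Data.Nat using (ℕ; suc; _+_; _≤_; _<_; z≤n; s≤s)
open import Data.Nat.Properties
  using (≤-trans; ≤-refl; ≤-reflexive; +-mono-≤; +-comm; n≤1+n; +-monoʳ-≤; +-monoˡ-≤; +-suc; +-identityʳ; module ≤-Reasoning)
open import Data.Bool using (true; false)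
import Data.Bool as Bool
open import Data.Bool.Properties using (∧-zeroʳ; ¬-not)
open import Data.Fin using (Fin; fromℕ<; _↑ˡ_; _↑ʳ_; splitAt; _≟_)
open import Data.Fin.Properties
  using (splitAt-↑ˡ; splitAt-↑ʳ; splitAt⁻¹-↑ˡ; splitAt⁻¹-↑ʳ; ↑ˡ-injective; ↑ʳ-injective; any?; all?; ¬∀⟶∃¬)
open import Data.Fin.Subset using (Subset; inside; outside; _∈_; ∣_∣; ⊤; ⊥; ⁅_⁆; _∪_)
open import Data.Fin.Subset.Properties using (x∈p∪q⁺; x∈⁅x⁆; ∣⊤∣≡n; ∣⊥∣≡0; ∣⁅x⁆∣≡1)
open import Data.Vec using (_++_; lookup; tabulate; _∷_; [])
open import Data.Vec.Properties using (lookup⇒[]=; []=⇒lookup; lookup-++ˡ; lookup-++ʳ; lookup-replicate; lookup∘tabulate)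
open import Data.Sum using (_⊎_; inj₁; inj₂)
open import Data.Product using (_×_; _,_; ∃; proj₁; proj₂)
open import Data.Empty using (⊥-elim)
open import Relation.Nullary using (¬_; Dec; yes; no; ⌊_⌋)
open import Relation.Nullary.Decidable using (_⊎-dec_; _×-dec_; dec-true; dec-false; isYes≗does)
open import Relation.Binary.PropositionalEquality

-- Walks and intervals in an arbitrary graph.
module _ (H : Graph) where

  append : ∀ {x y z k l} → Walk H x y k → Walk H y z l → Walk H x z (k + l)
  append (nil _)    w′ = w′
  append (cons e w) w′ = cons e (append w w′)

  adjacent⇒≢ : ∀ {x y} → adj H x y ≡ true → x ≢ y
  adjacent⇒≢ {x} xy refl with trans (sym xy) (irrefl H x)
  ... | ()

  nonadjacent⇒2≤length : ∀ {x y k} → x ≢ y → adj H x y ≡ false → Walk H x y k → 2 ≤ k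
  nonadjacent⇒2≤length x≢y _      (nil _)          = ⊥-elim (x≢y refl)
  nonadjacent⇒2≤length _   nonadj (cons xy (nil _)) with trans (sym xy) nonadj
  ... | ()
  nonadjacent⇒2≤length _   _      (cons _ (cons _ _)) = s≤s (s≤s z≤n)

  -- A common neighbour of two distinct non-adjacent vertices lies in their
  -- interval, the two vertices being at distance exactly 2.
  commonNeighbour∈I : ∀ {x y z} → x ≢ y → adj H x y ≡ false →
                      adj H x z ≡ true → adj H z y ≡ true → InInterval H x y z
  commonNeighbour∈I {y = y} {z} x≢y nonadj xz zy = inj₂ (inj₂ (2 , 1 , 1 ,
    (cons xz (cons zy (nil y)) , λ _ → nonadjacent⇒2≤length x≢y nonadj) ,
    cons xz (nil z) , cons zy (nil y) , refl))

-- Pulling convex sets back along a vertex map f : G → H.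
module _ {G H : Graph} (f : Fin (n G) → Fin (n H)) where

  PreservesIntervals : Set
  PreservesIntervals = ∀ {x y z} → InInterval G x y z → InInterval H (f x) (f y) (f z)

  preimage : Subset (n H) → Subset (n G)
  preimage C = tabulate (λ a → lookup C (f a))

  ∈preimage⁺ : ∀ {C a} → f a ∈ C → a ∈ preimage C
  ∈preimage⁺ {C} {a} fa∈C =
    lookup⇒[]= a (preimage C) (trans (lookup∘tabulate (λ b → lookup C (f b)) a) ([]=⇒lookup fa∈C))

  ∈preimage⁻ : ∀ {C a} → a ∈ preimage C → f a ∈ C
  ∈preimage⁻ {C} {a} a∈ =
    lookup⇒[]= (f a) C (trans (sym (lookup∘tabulate (λ b → lookup C (f b)) a)) ([]=⇒lookup a∈))

  convex-preimage : PreservesIntervals → ∀ {C} → Convex H C → Convex G (preimage C)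
  convex-preimage preserves convex x y z x∈ y∈ z∈I =
    ∈preimage⁺ (convex (f x) (f y) (f z) (∈preimage⁻ x∈) (∈preimage⁻ y∈) (preserves z∈I))

  hull-image : PreservesIntervals → ∀ {S C} → IsHullSet G S → Convex H C →
               (∀ {a} → a ∈ S → f a ∈ C) → ∀ a → f a ∈ C
  hull-image preserves {C = C} hull convex S↦C a =
    ∈preimage⁻ (hull (preimage C) (convex-preimage preserves convex) (λ a∈S → ∈preimage⁺ (S↦C a∈S)) a)

module _ {G H : Graph} (f : Fin (n G) → Fin (n H))
         (f-adj : ∀ {a b} → adj G a b ≡ true → adj H (f a) (f b) ≡ true) where

  mapWalk : ∀ {a b k} → Walk G a b k → Walk H (f a) (f b) k
  mapWalk (nil a)    = nil (f a)
  mapWalk (cons e w) = cons (f-adj e) (mapWalk w)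

  preservesIntervals : (∀ {a b d k} → IsDist G a b d → Walk H (f a) (f b) k → d ≤ k) →
                       PreservesIntervals f
  preservesIntervals _ (inj₁ z≡x)        = inj₁ (cong f z≡x)
  preservesIntervals _ (inj₂ (inj₁ z≡y)) = inj₂ (inj₁ (cong f z≡y))
  preservesIntervals reflects (inj₂ (inj₂ (d , a , b , dist , wa , wb , a+b≡d))) =
    inj₂ (inj₂ (d , a , b , (mapWalk (proj₁ dist) , λ _ → reflects dist) , mapWalk wa , mapWalk wb , a+b≡d))

module _ (G : Graph) where

  Near : Fin (n G) → Fin (n G) → Set
  Near a b = a ≡ b ⊎ adj G a b ≡ true

  Within3 : Fin (n G) → Fin (n G) → Set
  Within3 a b = ∃ λ c → ∃ λ d → Near a c × Near c d × Near d b

  near? : ∀ a b → Dec (Near a b)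
  near? a b = (a ≟ b) ⊎-dec (adj G a b Bool.≟ true)

  within3? : ∀ a b → Dec (Within3 a b)
  within3? a b = any? λ c → any? λ d → near? a c ×-dec (near? c d ×-dec near? d b)

  near-sym : ∀ {a b} → Near a b → Near b a
  near-sym (inj₁ a≡b) = inj₁ (sym a≡b)
  near-sym {a} {b} (inj₂ ab) = inj₂ (trans (adj-sym G b a) ab)

  ¬near⇒ : ∀ {a b} → ¬ Near a b → a ≢ b × adj G a b ≡ false
  ¬near⇒ far = (λ a≡b → far (inj₁ a≡b)) , ¬-not (λ ab → far (inj₂ ab))

  near⇒walk : ∀ {a b} → Near a b → ∃ λ k → k ≤ 1 × Walk G a b k
  near⇒walk {a} (inj₁ refl) = 0 , z≤n , nil a
  near⇒walk {b = b} (inj₂ ab) = 1 , ≤-refl , cons ab (nil b)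

  within3⇒walk : ∀ {a b} → Within3 a b → ∃ λ k → k ≤ 3 × Walk G a b k
  within3⇒walk (_ , _ , ac , cd , db) with near⇒walk ac | near⇒walk cd | near⇒walk db
  ... | (k₁ , k₁≤1 , w₁) | (k₂ , k₂≤1 , w₂) | (k₃ , k₃≤1 , w₃) =
    k₁ + (k₂ + k₃) , +-mono-≤ k₁≤1 (+-mono-≤ k₂≤1 k₃≤1) , append G w₁ (append G w₂ w₃)

  record LongPath : Set where
    field
      p₀ p₁ p₂ p₃ p₄ : Fin (n G)
      p₀p₁ : adj G p₀ p₁ ≡ true
      p₁p₂ : adj G p₁ p₂ ≡ true
      p₂p₃ : adj G p₂ p₃ ≡ true
      p₃p₄ : adj G p₃ p₄ ≡ true
      far  : ¬ Within3 p₀ p₄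

  -- Follow a walk from z (within 3 of x) to y (not within 3 of x); at the
  -- first step leaving the 3-ball around x the witnessing chain x c d z must
  -- consist of genuine edges, which together with that step is a long path.
  leave-ball : ∀ {x y z k} → ¬ Within3 x y → Within3 x z → Walk G z y k → LongPath
  leave-ball x↛y x→z (nil _) = ⊥-elim (x↛y x→z)
  leave-ball {x} x↛y x→z (cons {y = z′} zz′ w) with within3? x z′
  ... | yes x→z′ = leave-ball x↛y x→z′ w
  ... | no x↛z′ with x→z
  ...   | (c , d , inj₁ refl , cd , dz) = ⊥-elim (x↛z′ (d , _ , cd , dz , inj₂ zz′))
  ...   | (c , d , inj₂ xc , inj₁ refl , dz) = ⊥-elim (x↛z′ (c , _ , inj₂ xc , dz , inj₂ zz′))
  ...   | (c , d , inj₂ xc , inj₂ cd , inj₁ refl) = ⊥-elim (x↛z′ (c , d , inj₂ xc , inj₂ cd , inj₂ zz′))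
  ...   | (c , d , inj₂ xc , inj₂ cd , inj₂ dz) = record
          { p₀ = x ; p₁ = c ; p₂ = d ; p₃ = _ ; p₄ = z′
          ; p₀p₁ = xc ; p₁p₂ = cd ; p₂p₃ = dz ; p₃p₄ = zz′ ; far = x↛z′ }

  -- In a connected graph of diameter > 3 some pair is not within 3 steps,
  -- and any walk between them crosses the boundary of the 3-ball.
  longPath : Connected G → ¬ DiamLe G 3 → LongPath
  longPath connected diam>3
    with ¬∀⟶∃¬ (n G) (λ x → ∀ y → Within3 x y) (λ x → all? (within3? x)) all-within3
    where
      all-within3 : ¬ (∀ x y → Within3 x y)
      all-within3 close = diam>3 λ x y d dist →
        let (k , k≤3 , w) = within3⇒walk (close x y) in ≤-trans (proj₂ dist k w) k≤3
  ... | (x , x↛) with ¬∀⟶∃¬ (n G) (Within3 x) (within3? x) x↛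
  ...   | (y , x↛y) = leave-ball x↛y (x , x , inj₁ refl , inj₁ refl , inj₁ refl) (proj₂ (connected x y))

∣p++q∣ : ∀ {m k} (p : Subset m) (q : Subset k) → ∣ p ++ q ∣ ≡ ∣ p ∣ + ∣ q ∣
∣p++q∣ []           q = refl
∣p++q∣ (inside ∷ p)  q = cong suc (∣p++q∣ p q)
∣p++q∣ (outside ∷ p) q = ∣p++q∣ p q

∣p∪q∣≤∣p∣+∣q∣ : ∀ {m} (p q : Subset m) → ∣ p ∪ q ∣ ≤ ∣ p ∣ + ∣ q ∣
∣p∪q∣≤∣p∣+∣q∣ []            []            = z≤n
∣p∪q∣≤∣p∣+∣q∣ (inside ∷ p)  (inside ∷ q)  = s≤s (≤-trans (∣p∪q∣≤∣p∣+∣q∣ p q) (+-monoʳ-≤ ∣ p ∣ (n≤1+n _)))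
∣p∪q∣≤∣p∣+∣q∣ (inside ∷ p)  (outside ∷ q) = s≤s (∣p∪q∣≤∣p∣+∣q∣ p q)
∣p∪q∣≤∣p∣+∣q∣ (outside ∷ p) (inside ∷ q)  = ≤-trans (s≤s (∣p∪q∣≤∣p∣+∣q∣ p q)) (≤-reflexive (sym (+-suc ∣ p ∣ ∣ q ∣)))
∣p∪q∣≤∣p∣+∣q∣ (outside ∷ p) (outside ∷ q) = ∣p∪q∣≤∣p∣+∣q∣ p q

↑ˡ≢↑ʳ : ∀ {m k} (i : Fin m) (j : Fin k) → i ↑ˡ k ≢ m ↑ʳ j
↑ˡ≢↑ʳ {m} {k} i j eq with trans (sym (splitAt-↑ˡ m i k)) (trans (cong (splitAt m) eq) (splitAt-↑ʳ m k j))
... | ()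

⌊≟⌋-refl : ∀ {m} (i : Fin m) → ⌊ i ≟ i ⌋ ≡ true
⌊≟⌋-refl i = trans (isYes≗does (i ≟ i)) (dec-true (i ≟ i) refl)

⌊≟⌋-≢ : ∀ {m} {i j : Fin m} → i ≢ j → ⌊ i ≟ j ⌋ ≡ false
⌊≟⌋-≢ {i = i} {j} i≢j = trans (isYes≗does (i ≟ j)) (dec-false (i ≟ j) i≢j)

⌊≟⌋-true⇒≡ : ∀ {m} {i j : Fin m} → ⌊ i ≟ j ⌋ ≡ true → i ≡ j
⌊≟⌋-true⇒≡ {i = i} {j} eq with i ≟ j
... | yes i≡j = i≡j
⌊≟⌋-true⇒≡ () | no _

-- The complementary prism P of G₁ + t·K₁.
module Prism (G₁ : Graph) (t : ℕ) where

  private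
    N : ℕ
    N = n G₁ + t

  P : Graph
  P = ComplementaryPrism (AddIsolated G₁ t)

  v v̄ : Fin (n G₁) → Fin (n P)
  v  a = (a ↑ˡ t) ↑ˡ N
  v̄ a = N ↑ʳ (a ↑ˡ t)

  u ū : Fin t → Fin (n P)
  u  j = (n G₁ ↑ʳ j) ↑ˡ N
  ū j = N ↑ʳ (n G₁ ↑ʳ j)

  data View : Fin (n P) → Set where
    is-v  : ∀ a → View (v a)
    is-u  : ∀ j → View (u j)
    is-v̄ : ∀ a → View (v̄ a)
    is-ū : ∀ j → View (ū j)

  view : ∀ x → View x
  view x with splitAt N x in e₁
  ... | inj₁ i with splitAt (n G₁) i in e₂
  ...   | inj₁ a = subst View (trans (cong (_↑ˡ N) (splitAt⁻¹-↑ˡ e₂)) (splitAt⁻¹-↑ˡ e₁)) (is-v a)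
  ...   | inj₂ j = subst View (trans (cong (_↑ˡ N) (splitAt⁻¹-↑ʳ e₂)) (splitAt⁻¹-↑ˡ e₁)) (is-u j)
  view x | inj₂ i with splitAt (n G₁) i in e₂
  ...   | inj₁ a = subst View (trans (cong (N ↑ʳ_) (splitAt⁻¹-↑ˡ e₂)) (splitAt⁻¹-↑ʳ e₁)) (is-v̄ a)
  ...   | inj₂ j = subst View (trans (cong (N ↑ʳ_) (splitAt⁻¹-↑ʳ e₂)) (splitAt⁻¹-↑ʳ e₁)) (is-ū j)

  v-injective : ∀ {a b} → v a ≡ v b → a ≡ b
  v-injective {a} {b} eq = ↑ˡ-injective t a b (↑ˡ-injective N (a ↑ˡ t) (b ↑ˡ t) eq)

  v̄-injective : ∀ {a b} → v̄ a ≡ v̄ b → a ≡ b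
  v̄-injective {a} {b} eq = ↑ˡ-injective t a b (↑ʳ-injective N (a ↑ˡ t) (b ↑ˡ t) eq)

  v≢u : ∀ a j → v a ≢ u j
  v≢u a j eq = ↑ˡ≢↑ʳ a j (↑ˡ-injective N (a ↑ˡ t) (n G₁ ↑ʳ j) eq)

  v≢v̄ : ∀ a b → v a ≢ v̄ b
  v≢v̄ a b = ↑ˡ≢↑ʳ (a ↑ˡ t) (b ↑ˡ t)

  v≢ū : ∀ a j → v a ≢ ū j
  v≢ū a j = ↑ˡ≢↑ʳ (a ↑ˡ t) (n G₁ ↑ʳ j)

  private
    split-v : ∀ a → splitAt N (v a) ≡ inj₁ (a ↑ˡ t)
    split-v a = splitAt-↑ˡ N (a ↑ˡ t) N
    split-u : ∀ j → splitAt N (u j) ≡ inj₁ (n G₁ ↑ʳ j)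
    split-u j = splitAt-↑ˡ N (n G₁ ↑ʳ j) N
    split-v̄ : ∀ a → splitAt N (v̄ a) ≡ inj₂ (a ↑ˡ t)
    split-v̄ a = splitAt-↑ʳ N N (a ↑ˡ t)
    split-ū : ∀ j → splitAt N (ū j) ≡ inj₂ (n G₁ ↑ʳ j)
    split-ū j = splitAt-↑ʳ N N (n G₁ ↑ʳ j)
    split-core : ∀ a → splitAt (n G₁) (a ↑ˡ t) ≡ inj₁ a
    split-core a = splitAt-↑ˡ (n G₁) a t
    split-iso : ∀ j → splitAt (n G₁) (n G₁ ↑ʳ j) ≡ inj₂ j
    split-iso j = splitAt-↑ʳ (n G₁) t j
    core≢iso : ∀ a j → ⌊ (a ↑ˡ t) ≟ (n G₁ ↑ʳ j) ⌋ ≡ false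
    core≢iso a j = ⌊≟⌋-≢ (↑ˡ≢↑ʳ a j)

  adj-v-v : ∀ a b → adj P (v a) (v b) ≡ adj G₁ a b
  adj-v-v a b rewrite split-v a | split-v b | split-core a | split-core b = refl

  adj-v-u : ∀ a j → adj P (v a) (u j) ≡ false
  adj-v-u a j rewrite split-v a | split-u j | split-core a | split-iso j = refl

  adj-v-v̄ : ∀ a b → adj P (v a) (v̄ b) ≡ ⌊ (a ↑ˡ t) ≟ (b ↑ˡ t) ⌋
  adj-v-v̄ a b rewrite split-v a | split-v̄ b = refl

  adj-v-ū : ∀ a j → adj P (v a) (ū j) ≡ false
  adj-v-ū a j rewrite split-v a | split-ū j = core≢iso a j

  adj-u-u : ∀ i j → adj P (u i) (u j) ≡ false
  adj-u-u i j rewrite split-u i | split-u j | split-iso i | split-iso j = refl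

  adj-u-v̄ : ∀ j a → adj P (u j) (v̄ a) ≡ false
  adj-u-v̄ j a rewrite split-u j | split-v̄ a = ⌊≟⌋-≢ (λ eq → ↑ˡ≢↑ʳ a j (sym eq))

  adj-u-ū : ∀ i j → adj P (u i) (ū j) ≡ ⌊ (n G₁ ↑ʳ i) ≟ (n G₁ ↑ʳ j) ⌋
  adj-u-ū i j rewrite split-u i | split-ū j = refl

  adj-v̄-v̄ : ∀ a b → adj P (v̄ a) (v̄ b) ≡ Bool.not (⌊ (a ↑ˡ t) ≟ (b ↑ˡ t) ⌋) Bool.∧ Bool.not (adj G₁ a b)
  adj-v̄-v̄ a b rewrite split-v̄ a | split-v̄ b | split-core a | split-core b = refl

  adj-v̄-ū : ∀ a j → adj P (v̄ a) (ū j) ≡ true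
  adj-v̄-ū a j rewrite split-v̄ a | split-ū j | split-core a | split-iso j | core≢iso a j = refl

  v-v̄ : ∀ a → adj P (v a) (v̄ a) ≡ true
  v-v̄ a = trans (adj-v-v̄ a a) (⌊≟⌋-refl _)

  v̄-v : ∀ a → adj P (v̄ a) (v a) ≡ true
  v̄-v a = trans (adj-sym P (v̄ a) (v a)) (v-v̄ a)

  v-v̄⇒≡ : ∀ {a b} → adj P (v a) (v̄ b) ≡ true → a ≡ b
  v-v̄⇒≡ {a} {b} ab = ↑ˡ-injective t a b (⌊≟⌋-true⇒≡ (trans (sym (adj-v-v̄ a b)) ab))

  v̄-v-≢ : ∀ {a b} → a ≢ b → adj P (v̄ a) (v b) ≡ false
  v̄-v-≢ {a} {b} a≢b = trans (adj-sym P (v̄ a) (v b))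
    (trans (adj-v-v̄ b a) (⌊≟⌋-≢ (λ eq → a≢b (sym (↑ˡ-injective t b a eq)))))

  u-ū : ∀ j → adj P (u j) (ū j) ≡ true
  u-ū j = trans (adj-u-ū j j) (⌊≟⌋-refl _)

  ū-v̄ : ∀ j a → adj P (ū j) (v̄ a) ≡ true
  ū-v̄ j a = trans (adj-sym P (ū j) (v̄ a)) (adj-v̄-ū a j)

  v̄-v̄-adjacent : ∀ {a b} → adj G₁ a b ≡ true → adj P (v̄ a) (v̄ b) ≡ false
  v̄-v̄-adjacent {a} {b} ab = trans (adj-v̄-v̄ a b)
    (trans (cong (λ e → Bool.not (⌊ (a ↑ˡ t) ≟ (b ↑ˡ t) ⌋) Bool.∧ Bool.not e) ab) (∧-zeroʳ _))

  v̄-v̄-nonadjacent : ∀ {a b} → a ≢ b → adj G₁ a b ≡ false → adj P (v̄ a) (v̄ b) ≡ true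
  v̄-v̄-nonadjacent {a} {b} a≢b ab = trans (adj-v̄-v̄ a b)
    (cong₂ (λ e f → Bool.not e Bool.∧ Bool.not f) (⌊≟⌋-≢ (λ eq → a≢b (↑ˡ-injective t a b eq))) ab)

  u-neighbour : ∀ {j x} → adj P (u j) x ≡ true → x ≡ ū j
  u-neighbour {j} {x} ux with view x
  ... | is-v a with trans (sym ux) (trans (adj-sym P (u j) (v a)) (adj-v-u a j))
  ...   | ()
  u-neighbour {j} ux | is-u i with trans (sym ux) (adj-u-u j i)
  ...   | ()
  u-neighbour {j} ux | is-v̄ a with trans (sym ux) (adj-u-v̄ j a)
  ...   | ()
  u-neighbour {j} ux | is-ū i = cong ū (sym (↑ʳ-injective (n G₁) j i (⌊≟⌋-true⇒≡ (trans (sym (adj-u-ū j i)) ux))))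

  3≤|u-v| : ∀ {x y k j a} → Walk P x y k → x ≡ u j → y ≡ v a → 3 ≤ k
  3≤|u-v| {j = j} {a} (nil _) x≡u x≡v = ⊥-elim (v≢u a j (trans (sym x≡v) x≡u))
  3≤|u-v| {j = j} {a} (cons ux w) refl refl with u-neighbour ux
  ... | refl = s≤s (nonadjacent⇒2≤length P (λ eq → v≢ū a j (sym eq))
                     (trans (adj-sym P (ū j) (v a)) (adj-v-ū a j)) w)

  -- A walk in P between v a and v b either projects to a walk in G₁ that is no
  -- longer, or has length at least 3 (it passes through the barred copy).
  v-walk : ∀ {x y k} → Walk P x y k → ∀ {a b} → x ≡ v a → y ≡ v b →
           (∃ λ m → m ≤ k × Walk G₁ a b m) ⊎ 3 ≤ k
  v-walk (nil _) {a} {b} x≡v y≡v =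
    inj₁ (0 , z≤n , subst (λ c → Walk G₁ a c 0) (v-injective (trans (sym x≡v) y≡v)) (nil a))
  v-walk (cons {y = z} xz w) {a} {b} refl y≡v with view z
  ... | is-v c with v-walk w refl y≡v
  ...   | inj₁ (m , m≤ , w′) = inj₁ (suc m , s≤s m≤ , cons (trans (sym (adj-v-v a c)) xz) w′)
  ...   | inj₂ 3≤ = inj₂ (≤-trans 3≤ (n≤1+n _))
  v-walk (cons xz w) {a} refl y≡v | is-u j with trans (sym xz) (adj-v-u a j)
  ...   | ()
  v-walk (cons xz w) {a} refl y≡v | is-ū j with trans (sym xz) (adj-v-ū a j)
  ...   | ()
  v-walk (cons xz w) {a} {b} refl refl | is-v̄ c with v-v̄⇒≡ xz
  ... | refl with a ≟ b
  ...   | yes refl = inj₁ (0 , z≤n , nil a)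
  ...   | no a≢b = inj₂ (s≤s (nonadjacent⇒2≤length P (λ eq → v≢v̄ b a (sym eq)) (v̄-v-≢ a≢b) w))

  v-preservesIntervals : DiamLe G₁ 3 → PreservesIntervals v
  v-preservesIntervals diam≤3 = preservesIntervals v (λ {a} {b} ab → trans (adj-v-v a b) ab) reflects
    where
      reflects : ∀ {a b d k} → IsDist G₁ a b d → Walk P (v a) (v b) k → d ≤ k
      reflects {a} {b} {d} dist w with v-walk w refl refl
      ... | inj₁ (m , m≤k , w′) = ≤-trans (proj₂ dist m w′) m≤k
      ... | inj₂ 3≤k = ≤-trans (diam≤3 a b d dist) 3≤k

  u-ū-v̄-v : ∀ j a → IsDist P (u j) (v a) 3
  u-ū-v̄-v j a = cons (u-ū j) (cons (ū-v̄ j a) (cons (v̄-v a) (nil _))) , λ _ w → 3≤|u-v| w refl refl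

  v̄∈I[u,v] : ∀ j a → InInterval P (u j) (v a) (v̄ a)
  v̄∈I[u,v] j a = inj₂ (inj₂ (3 , 2 , 1 , u-ū-v̄-v j a ,
    cons (u-ū j) (cons (ū-v̄ j a) (nil _)) , cons (v̄-v a) (nil _) , refl))

  ū∈I[u,v] : ∀ j a → InInterval P (u j) (v a) (ū j)
  ū∈I[u,v] j a = inj₂ (inj₂ (3 , 1 , 2 , u-ū-v̄-v j a ,
    cons (u-ū j) (nil _) , cons (ū-v̄ j a) (cons (v̄-v a) (nil _)) , refl))

  v∈I[v,v] : ∀ {p q w} → ¬ Near G₁ p q → adj G₁ p w ≡ true → adj G₁ w q ≡ true →
             InInterval P (v p) (v q) (v w)
  v∈I[v,v] {p} {q} {w} far pw wq with ¬near⇒ G₁ far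
  ... | (p≢q , nonadj) = commonNeighbour∈I P (λ eq → p≢q (v-injective eq)) (trans (adj-v-v p q) nonadj)
                           (trans (adj-v-v p w) pw) (trans (adj-v-v w q) wq)

  v̄∈I[v̄,v̄] : ∀ {a b w} → adj G₁ a b ≡ true → ¬ Near G₁ a w → ¬ Near G₁ b w →
              InInterval P (v̄ a) (v̄ b) (v̄ w)
  v̄∈I[v̄,v̄] {a} {b} {w} ab far-a far-b with ¬near⇒ G₁ far-a | ¬near⇒ G₁ far-b
  ... | (a≢w , aw) | (b≢w , bw) =
    commonNeighbour∈I P (λ eq → adjacent⇒≢ G₁ ab (v̄-injective eq)) (v̄-v̄-adjacent ab)
      (v̄-v̄-nonadjacent a≢w aw) (v̄-v̄-nonadjacent (λ eq → b≢w (sym eq)) (trans (adj-sym G₁ w b) bw))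

  v∈I[v̄,v] : ∀ {a b} → adj G₁ a b ≡ true → InInterval P (v̄ a) (v b) (v a)
  v∈I[v̄,v] {a} {b} ab = commonNeighbour∈I P (λ eq → v≢v̄ b a (sym eq))
    (v̄-v-≢ (adjacent⇒≢ G₁ ab)) (v̄-v a) (trans (adj-v-v a b) ab)

  -- The candidate hull sets: the vertices v a with a ∈ X, and all u j.
  lift : Subset (n G₁) → Subset (n P)
  lift X = (X ++ ⊤) ++ ⊥

  ∣lift∣ : ∀ X → ∣ lift X ∣ ≡ ∣ X ∣ + t
  ∣lift∣ X = begin
    ∣ lift X ∣                  ≡⟨ ∣p++q∣ (X ++ ⊤) ⊥ ⟩
    ∣ X ++ ⊤ ∣ + ∣ ⊥ {N} ∣       ≡⟨ cong₂ _+_ (∣p++q∣ X ⊤) (∣⊥∣≡0 N) ⟩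
    (∣ X ∣ + ∣ ⊤ {t} ∣) + 0     ≡⟨ +-identityʳ _ ⟩
    ∣ X ∣ + ∣ ⊤ {t} ∣           ≡⟨ cong (∣ X ∣ +_) (∣⊤∣≡n t) ⟩
    ∣ X ∣ + t                   ∎
    where open ≡-Reasoning

  v∈lift : ∀ {X a} → a ∈ X → v a ∈ lift X
  v∈lift {X} {a} a∈X = lookup⇒[]= (v a) (lift X)
    (trans (lookup-++ˡ (X ++ ⊤) ⊥ (a ↑ˡ t)) (trans (lookup-++ˡ X ⊤ a) ([]=⇒lookup a∈X)))

  u∈lift : ∀ {X} j → u j ∈ lift X
  u∈lift {X} j = lookup⇒[]= (u j) (lift X)
    (trans (lookup-++ˡ (X ++ ⊤) ⊥ (n G₁ ↑ʳ j)) (trans (lookup-++ʳ X ⊤ j) (lookup-replicate j inside)))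

  -- Closure facts for a convex set C containing every u j (t > 0 is needed
  -- to have some u j₀ available).
  module Closure (j₀ : Fin t) {C : Subset (n P)} (convex : Convex P C) (u∈C : ∀ j → u j ∈ C) where

    v̄∈C : ∀ {a} → v a ∈ C → v̄ a ∈ C
    v̄∈C {a} va∈C = convex (u j₀) (v a) (v̄ a) (u∈C j₀) va∈C (v̄∈I[u,v] j₀ a)

    complete : Fin (n G₁) → (∀ a → v a ∈ C) → ∀ x → x ∈ C
    complete a₀ v∈C x = go (view x)
      where
        go : ∀ {x} → View x → x ∈ C
        go (is-v a)  = v∈C a
        go (is-u j)  = u∈C j
        go (is-v̄ a) = v̄∈C (v∈C a)
        go (is-ū j) = convex (u j) (v a₀) (ū j) (u∈C j) (v∈C a₀) (ū∈I[u,v] j a₀)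

  small-diameter-hull : DiamLe G₁ 3 → ∀ {S} → IsHullSet G₁ S → Fin t → Fin (n G₁) → IsHullSet P (lift S)
  small-diameter-hull diam≤3 S-hull j₀ a₀ C convex S⊆C = complete a₀ v∈C
    where
      open Closure j₀ convex (λ j → S⊆C (u∈lift j))
      v∈C : ∀ a → v a ∈ C
      v∈C = hull-image v (v-preservesIntervals diam≤3) S-hull convex (λ a∈S → S⊆C (v∈lift a∈S))

  long-path-hull : Connected G₁ → (L : LongPath G₁) → Fin t →
                   IsHullSet P (lift (⁅ LongPath.p₁ L ⁆ ∪ ⁅ LongPath.p₃ L ⁆))
  long-path-hull connected L j₀ C convex S⊆C = complete p₁ v∈C
    where
      open LongPath L
      open Closure j₀ convex (λ j → S⊆C (u∈lift j))

      vp₁ : v p₁ ∈ C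
      vp₁ = S⊆C (v∈lift (x∈p∪q⁺ (inj₁ (x∈⁅x⁆ p₁))))
      vp₃ : v p₃ ∈ C
      vp₃ = S⊆C (v∈lift (x∈p∪q⁺ (inj₂ (x∈⁅x⁆ p₃))))

      between₁₃ : ∀ {w} → adj G₁ p₁ w ≡ true → adj G₁ w p₃ ≡ true → v w ∈ C
      between₁₃ p₁w wp₃ = convex (v p₁) (v p₃) _ vp₁ vp₃
        (v∈I[v,v] (λ near → far (p₁ , p₃ , inj₂ p₀p₁ , near , inj₂ p₃p₄)) p₁w wp₃)

      v̄p₀ : v̄ p₀ ∈ C
      v̄p₀ = convex (v̄ p₂) (v̄ p₃) (v̄ p₀) (v̄∈C (between₁₃ p₁p₂ p₂p₃)) (v̄∈C vp₃) (v̄∈I[v̄,v̄] p₂p₃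
        (λ near → far (p₂ , p₃ , near-sym G₁ near , inj₂ p₂p₃ , inj₂ p₃p₄))
        (λ near → far (p₃ , p₄ , near-sym G₁ near , inj₂ p₃p₄ , inj₁ refl)))

      v̄p₄ : v̄ p₄ ∈ C
      v̄p₄ = convex (v̄ p₁) (v̄ p₂) (v̄ p₄) (v̄∈C vp₁) (v̄∈C (between₁₃ p₁p₂ p₂p₃)) (v̄∈I[v̄,v̄] p₁p₂
        (λ near → far (p₁ , p₄ , inj₂ p₀p₁ , near , inj₁ refl))
        (λ near → far (p₁ , p₂ , inj₂ p₀p₁ , inj₂ p₁p₂ , near)))

      -- Each w is either far from an edge p₀p₁ or p₃p₄, or a common
      -- neighbour of p₁ and p₃ (or one of them): in all cases v̄ w ∈ C.
      v̄∈C′ : ∀ w → v̄ w ∈ C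
      v̄∈C′ w with near? G₁ p₀ w | near? G₁ p₁ w | near? G₁ p₃ w | near? G₁ p₄ w
      ... | no p₀↛w | no p₁↛w | _ | _ = convex (v̄ p₀) (v̄ p₁) (v̄ w) v̄p₀ (v̄∈C vp₁) (v̄∈I[v̄,v̄] p₀p₁ p₀↛w p₁↛w)
      ... | _ | _ | no p₃↛w | no p₄↛w = convex (v̄ p₃) (v̄ p₄) (v̄ w) (v̄∈C vp₃) v̄p₄ (v̄∈I[v̄,v̄] p₃p₄ p₃↛w p₄↛w)
      ... | yes p₀w | _ | yes p₃w | _ = ⊥-elim (far (w , p₃ , p₀w , near-sym G₁ p₃w , inj₂ p₃p₄))
      ... | yes p₀w | _ | _ | yes p₄w = ⊥-elim (far (w , p₄ , p₀w , near-sym G₁ p₄w , inj₁ refl))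
      ... | _ | yes p₁w | _ | yes p₄w = ⊥-elim (far (p₁ , w , inj₂ p₀p₁ , p₁w , near-sym G₁ p₄w))
      ... | _ | yes (inj₁ refl) | yes _ | _ = v̄∈C vp₁
      ... | _ | yes (inj₂ _) | yes (inj₁ refl) | _ = v̄∈C vp₃
      ... | _ | yes (inj₂ p₁w) | yes (inj₂ p₃w) | _ = v̄∈C (between₁₃ p₁w (trans (adj-sym G₁ w p₃) p₃w))

      -- With all barred vertices present, v spreads along the edges of G₁.
      spread : ∀ {x a k} → Walk G₁ x a k → v x ∈ C → v a ∈ C
      spread (nil _) vx∈C = vx∈C
      spread (cons {x} {y} xy w) vx∈C =
        spread w (convex (v̄ y) (v x) (v y) (v̄∈C′ y) vx∈C (v∈I[v̄,v] (trans (adj-sym G₁ y x) xy)))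

      v∈C : ∀ a → v a ∈ C
      v∈C a = spread (proj₂ (connected p₁ a)) vp₁

theorem5 : (G₁ : Graph) (t : ℕ) → 2 ≤ n G₁ → Connected G₁ → 0 < t →
    (∀ k → IsHullNumber G₁ k →
      ∀ h → IsHullNumber (ComplementaryPrism (AddIsolated G₁ t)) h →
        (DiamLe G₁ 3 → h ≤ k + t) × (¬ DiamLe G₁ 3 → h ≤ t + 2))
theorem5 G₁ t 2≤n connected 0<t k ((S , S-hull , ∣S∣≡k) , _) h (_ , minimal) = small , large
  where
    open Prism G₁ t
    open ≤-Reasoning

    small : DiamLe G₁ 3 → h ≤ k + t
    small diam≤3 = begin
      h          ≤⟨ minimal (lift S) (small-diameter-hull diam≤3 S-hull (fromℕ< 0<t) (fromℕ< 2≤n)) ⟩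
      ∣ lift S ∣ ≡⟨ ∣lift∣ S ⟩
      ∣ S ∣ + t  ≡⟨ cong (_+ t) ∣S∣≡k ⟩
      k + t      ∎

    large : ¬ DiamLe G₁ 3 → h ≤ t + 2
    large diam>3 = begin
      h                 ≤⟨ minimal (lift X) (long-path-hull connected L (fromℕ< 0<t)) ⟩
      ∣ lift X ∣        ≡⟨ ∣lift∣ X ⟩
      ∣ X ∣ + t         ≤⟨ +-monoˡ-≤ t (∣p∪q∣≤∣p∣+∣q∣ ⁅ p₁ ⁆ ⁅ p₃ ⁆) ⟩
      (∣ ⁅ p₁ ⁆ ∣ + ∣ ⁅ p₃ ⁆ ∣) + t ≡⟨ cong₂ (λ x y → (x + y) + t) (∣⁅x⁆∣≡1 p₁) (∣⁅x⁆∣≡1 p₃) ⟩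
      2 + t             ≡⟨ +-comm 2 t ⟩
      t + 2             ∎
      where
        L = longPath G₁ connected diam>3
        open LongPath L using (p₁; p₃)
        X = ⁅ p₁ ⁆ ∪ ⁅ p₃ ⁆
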